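{- Let $k,\ell$ be positive integers and let $\mathcal{F}\subseteq SOS_k(A_\ell)$ be an SOS-clique such that for any two pairs $\{\Gamma_i,\Gamma_j\}$ and $\{\Gamma_x,\Gamma_y\}$ of distinct elements of $\mathcal{F}$, $S(\Gamma_i,\Gamma_j)=S(\Gamma_x,\Gamma_y)$ holds if and only if $\{\Gamma_i,\Gamma_j\}=\{\Gamma_x,\Gamma_y\}$. Then $|\mathcal{F}|\le \binom{2k}{k}+1$.
   Context: Let $\varepsilon_1,\ldots,\varepsilon_{\ell+1}$ be the standard basis of $\mathbb{R}^{\ell+1}$. The root system $A_\ell$ is the set of vectors $\varepsilon_i-\varepsilon_j$, $i\neq j$. Two roots are strongly orthogonal if neither their sum nor their difference is a root (equivalently, in $A_\ell$, their supports are disjoint). $SOS_k(A_\ell)$ is the set of $k$-element subsets $\Gamma$ of $A_\ell$ whose elements are pairwise strongly orthogonal. For $\Gamma\in SOS_k(A_\ell)$ write $|\Gamma|=\sum_{\gamma\in\Gamma}\gamma\in\mathbb{R}^{\ell+1}$. A subset $\mathcal{F}\subseteq SOS_k(A_\ell)$ is an SOS-clique if for all distinct $\Gamma_i,\Gamma_j\in\mathcal{F}$ there exists $\Gamma_{i,j}\in SOS_k(A_\ell)$ with $|\Gamma_i|-|\Gamma_j|=|\Gamma_{i,j}|$. For $\Gamma,\Gamma'$ write $S(\Gamma,\Gamma')$ for the set of coordinates in which both $|\Gamma|$ and $|\Gamma'|$ are nonzero. -}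

module Defs where

open import Data.Nat using (ℕ; suc; _≤_; _+_; _*_)
open import Data.Nat.Combinatorics using (_C_) public
open import Data.Integer as ℤ using (ℤ; +_; _-_)
open import Data.Fin using (Fin; _≟_)
open import Data.List using (List; map; length; foldr)
open import Data.List.Relation.Unary.AllPairs using (AllPairs)
open import Data.List.Membership.Propositional using (_∈_)
open import Data.Product using (Σ; _×_; _,_; ∃)
open import Data.Sum using (_⊎_)
open import Relation.Nullary using (¬_; yes; no)
open import Relation.Binary.PropositionalEquality using (_≡_; _≢_)
open import Function.Bundles using (_⇔_)

-- Ambient space R^(ℓ+1): coordinates indexed by Fin (suc ℓ); vectors are
-- integer-valued functions (all vectors here are integral).
Vec : ℕ → Set
Vec ℓ = Fin (suc ℓ) → ℤ

record Root (ℓ : ℕ) : Set where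
  constructor root
  field
    a b   : Fin (suc ℓ)
    a≢b   : a ≢ b
open Root public

ε : ∀ {ℓ} → Fin (suc ℓ) → Vec ℓ
ε a c with c ≟ a
... | yes _ = + 1
... | no  _ = + 0

vecR : ∀ {ℓ} → Root ℓ → Vec ℓ
vecR r c = ε (a r) c - ε (b r) c

-- Strong orthogonality in A_ℓ: disjoint supports {a,b} ∩ {a',b'} = ∅.
StronglyOrthogonal : ∀ {ℓ} → Root ℓ → Root ℓ → Set
StronglyOrthogonal r s =
  (a r ≢ a s) × (a r ≢ b s) × (b r ≢ a s) × (b r ≢ b s)

-- An element of SOS_k(A_ℓ): k roots, pairwise strongly orthogonal.
-- (Pairwise strong orthogonality forces the k listed roots to be distinct,
-- so this is a k-element subset, represented by a list.)
record SOS (k ℓ : ℕ) : Set where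
  field
    roots  : List (Root ℓ)
    size   : length roots ≡ k
    pairSO : AllPairs StronglyOrthogonal roots
open SOS public

pairs : ∀ {k ℓ} → SOS k ℓ → List (Fin (suc ℓ) × Fin (suc ℓ))
pairs Γ = map (λ r → (a r , b r)) (roots Γ)

_≈Γ_ : ∀ {k ℓ} → SOS k ℓ → SOS k ℓ → Set
Γ ≈Γ Γ' = ∀ p → (p ∈ pairs Γ) ⇔ (p ∈ pairs Γ')

∣_∣Γ : ∀ {k ℓ} → SOS k ℓ → Vec ℓ
∣ Γ ∣Γ c = foldr (λ r s → vecR r c ℤ.+ s) (+ 0) (roots Γ)

-- SOS-clique, for a family F indexed by Fin m (elements pairwise distinct
-- is required separately).
IsSOSClique : ∀ {k ℓ m} → (Fin m → SOS k ℓ) → Set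
IsSOSClique {k} {ℓ} F = ∀ i j → i ≢ j →
  Σ (SOS k ℓ) λ Δ → ∀ c → ∣ F i ∣Γ c - ∣ F j ∣Γ c ≡ ∣ Δ ∣Γ c

InS : ∀ {k ℓ} → SOS k ℓ → SOS k ℓ → Fin (suc ℓ) → Set
InS Γ Γ' c = (∣ Γ ∣Γ c ≢ + 0) × (∣ Γ' ∣Γ c ≢ + 0)

SameS : ∀ {k ℓ} → SOS k ℓ → SOS k ℓ → SOS k ℓ → SOS k ℓ → Set
SameS Γ Γ' Δ Δ' = ∀ c → InS Γ Γ' c ⇔ InS Δ Δ' c

SamePair : ∀ {m} → Fin m → Fin m → Fin m → Fin m → Set
SamePair i j x y = (i ≡ x × j ≡ y) ⊎ (i ≡ y × j ≡ x)

module Submission where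

-- Fix Γ₀ = F 0. Since the roots of Γ ∈ SOS_k(A_ℓ) have disjoint supports, |Γ| has
-- entries in {0, ±1}, exactly 2k of them nonzero. For another member Γ of the clique,
-- |Γ₀| - |Γ| = |Δ| is again such a vector; where |Γ₀| and |Γ| are both nonzero their
-- difference can only be 0, so counting nonzero entries gives 2k = 2k + 2k - 2|S(Γ₀,Γ)|,
-- i.e. |S(Γ₀,Γ)| = k. By hypothesis these sets are pairwise distinct k-subsets of the
-- 2k-element support of |Γ₀|, so there are at most C(2k,k) members besides Γ₀.

open import Defs
open import Data.Nat using (ℕ; zero; suc; _≤_; _+_; _*_; z≤n; s≤s)
open import Data.Fin using (Fin; zero; suc; _≟_; punchIn)
open import Relation.Nullary using (¬_; yes; no)
open import Relation.Binary.PropositionalEquality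
  using (_≡_; _≢_; refl; sym; trans; cong; cong₂; subst; ≢-sym; module ≡-Reasoning)
open import Function using (_∘_; _⇔_; Injective; Equivalence; Inverse; mk⇔)
import Function.Properties.Equivalence as ⇔
import Data.Nat.Properties as ℕ
open import Data.Nat.Combinatorics using (nCk+nC[k+1]≡[n+1]C[k+1])
open import Algebra.Properties.Semiring.Sum ℕ.+-*-semiring
  using (sum; sum-cong-≗; ∑-distrib-+; *-distribˡ-sum; sum-remove; sum-replicate-zero)
open import Data.Integer as ℤ using (ℤ; +_; -[1+_]; -_)
import Data.Integer.Properties as ℤ
open import Data.Fin.Properties using (punchInᵢ≢i; injective⇒≤)
open import Data.Fin.Subset using (Subset; inside; outside; _∈_; _⊆_; _∩_; ∣_∣)
open import Data.Fin.Subset.Properties using (drop-∷-⊆; p∩q⊆p; ∩⇔×)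
open import Data.Bool using (Bool; true; false; _∧_)
open import Data.Vec using ([]; _∷_; tabulate)
import Data.Vec as Vector
open import Data.Vec.Properties using (lookup∘tabulate; []=↔lookup)
open import Data.List using (List; []; _∷_; [_]; map; _++_; length; foldr; lookup)
open import Data.List.Properties using (length-++; length-map)
open import Data.List.Relation.Unary.All using (All; []; _∷_)
import Data.List.Relation.Unary.All as All
open import Data.List.Relation.Unary.AllPairs using (AllPairs; []; _∷_)
open import Data.List.Relation.Unary.Any using (here; index)
open import Data.List.Relation.Unary.Any.Properties using (lookup-index)
import Data.List.Membership.Propositional as List
open import Data.List.Membership.Propositional.Properties using (∈-map⁺; ∈-++⁺ˡ; ∈-++⁺ʳ)
open import Data.Product using (_×_; _,_; proj₁; proj₂)
open import Data.Sum using (_⊎_; inj₁; inj₂)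
open import Data.Empty using (⊥-elim)

private variable
  n k ℓ : ℕ

data Sign : ℤ → Set where
  0ˢ  : Sign (+ 0)
  +1ˢ : Sign (+ 1)
  -1ˢ : Sign -[1+ 0 ]

sign-neg : ∀ {u} → Sign u → Sign (- u)
sign-neg 0ˢ  = 0ˢ
sign-neg +1ˢ = -1ˢ
sign-neg -1ˢ = +1ˢ

sign-+-disjoint : ∀ {u v} → Sign u → Sign v → u ≡ + 0 ⊎ v ≡ + 0 → Sign (u ℤ.+ v)
sign-+-disjoint {v = v} _ sv (inj₁ refl) = subst Sign (sym (ℤ.+-identityˡ v)) sv
sign-+-disjoint {u = u} su _ (inj₂ refl) = subst Sign (sym (ℤ.+-identityʳ u)) su

∣+∣-disjoint : ∀ {u v} → u ≡ + 0 ⊎ v ≡ + 0 → ℤ.∣ u ℤ.+ v ∣ ≡ ℤ.∣ u ∣ + ℤ.∣ v ∣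
∣+∣-disjoint {v = v} (inj₁ refl) = cong ℤ.∣_∣ (ℤ.+-identityˡ v)
∣+∣-disjoint {u = u} (inj₂ refl) = trans (cong ℤ.∣_∣ (ℤ.+-identityʳ u)) (sym (ℕ.+-identityʳ ℤ.∣ u ∣))

-- If x and y are both ±1 and x - y is still a sign, then x = y.
∣x-y∣+2∣x∣∣y∣≡∣x∣+∣y∣ : ∀ {x y} → Sign x → Sign y → Sign (x ℤ.- y) →
  ℤ.∣ x ℤ.- y ∣ + 2 * (ℤ.∣ x ∣ * ℤ.∣ y ∣) ≡ ℤ.∣ x ∣ + ℤ.∣ y ∣
∣x-y∣+2∣x∣∣y∣≡∣x∣+∣y∣ 0ˢ  0ˢ  _ = refl
∣x-y∣+2∣x∣∣y∣≡∣x∣+∣y∣ 0ˢ  +1ˢ _ = refl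
∣x-y∣+2∣x∣∣y∣≡∣x∣+∣y∣ 0ˢ  -1ˢ _ = refl
∣x-y∣+2∣x∣∣y∣≡∣x∣+∣y∣ +1ˢ 0ˢ  _ = refl
∣x-y∣+2∣x∣∣y∣≡∣x∣+∣y∣ +1ˢ +1ˢ _ = refl
∣x-y∣+2∣x∣∣y∣≡∣x∣+∣y∣ +1ˢ -1ˢ ()
∣x-y∣+2∣x∣∣y∣≡∣x∣+∣y∣ -1ˢ 0ˢ  _ = refl
∣x-y∣+2∣x∣∣y∣≡∣x∣+∣y∣ -1ˢ +1ˢ ()
∣x-y∣+2∣x∣∣y∣≡∣x∣+∣y∣ -1ˢ -1ˢ _ = refl

∑∣u-v∣+2∑∣u∣∣v∣≡∑∣u∣+∑∣v∣ : ∀ {u v : Fin n → ℤ} →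
  (∀ c → Sign (u c)) → (∀ c → Sign (v c)) → (∀ c → Sign (u c ℤ.- v c)) →
  sum (λ c → ℤ.∣ u c ℤ.- v c ∣) + 2 * sum (λ c → ℤ.∣ u c ∣ * ℤ.∣ v c ∣)
    ≡ sum (λ c → ℤ.∣ u c ∣) + sum (λ c → ℤ.∣ v c ∣)
∑∣u-v∣+2∑∣u∣∣v∣≡∑∣u∣+∑∣v∣ {u = u} {v} su sv sd = begin
  sum ∣u-v∣ + 2 * sum ∣u∣∣v∣             ≡⟨ cong (_+_ (sum ∣u-v∣)) (*-distribˡ-sum 2 ∣u∣∣v∣) ⟩
  sum ∣u-v∣ + sum (λ c → 2 * ∣u∣∣v∣ c)   ≡⟨ ∑-distrib-+ ∣u-v∣ (λ c → 2 * ∣u∣∣v∣ c) ⟨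
  sum (λ c → ∣u-v∣ c + 2 * ∣u∣∣v∣ c)     ≡⟨ sum-cong-≗ (λ c → ∣x-y∣+2∣x∣∣y∣≡∣x∣+∣y∣ (su c) (sv c) (sd c)) ⟩
  sum (λ c → ℤ.∣ u c ∣ + ℤ.∣ v c ∣)      ≡⟨ ∑-distrib-+ (ℤ.∣_∣ ∘ u) (ℤ.∣_∣ ∘ v) ⟩
  sum (ℤ.∣_∣ ∘ u) + sum (ℤ.∣_∣ ∘ v)      ∎
  where
  open ≡-Reasoning
  ∣u-v∣ ∣u∣∣v∣ : Fin _ → ℕ
  ∣u-v∣ c = ℤ.∣ u c ℤ.- v c ∣
  ∣u∣∣v∣ c = ℤ.∣ u c ∣ * ℤ.∣ v c ∣

subsetsOfSize : Subset n → ℕ → List (Subset n)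
subsetsOfSize []            zero    = [ [] ]
subsetsOfSize []            (suc k) = []
subsetsOfSize (outside ∷ t) k       = map (outside ∷_) (subsetsOfSize t k)
subsetsOfSize (inside ∷ t)  zero    = map (outside ∷_) (subsetsOfSize t zero)
subsetsOfSize (inside ∷ t)  (suc k) =
  map (inside ∷_) (subsetsOfSize t k) ++ map (outside ∷_) (subsetsOfSize t (suc k))

length-subsetsOfSize : (t : Subset n) (k : ℕ) → length (subsetsOfSize t k) ≡ ∣ t ∣ C k
length-subsetsOfSize []            zero    = refl
length-subsetsOfSize []            (suc k) = refl
length-subsetsOfSize (outside ∷ t) k       =
  trans (length-map _ (subsetsOfSize t k)) (length-subsetsOfSize t k)
length-subsetsOfSize (inside ∷ t)  zero    =
  trans (length-map _ (subsetsOfSize t zero)) (length-subsetsOfSize t zero)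
length-subsetsOfSize (inside ∷ t)  (suc k) = begin
  length (map (inside ∷_) (subsetsOfSize t k) ++ map (outside ∷_) (subsetsOfSize t (suc k)))
    ≡⟨ length-++ (map (inside ∷_) (subsetsOfSize t k)) ⟩
  length (map (inside ∷_) (subsetsOfSize t k)) + length (map (outside ∷_) (subsetsOfSize t (suc k)))
    ≡⟨ cong₂ _+_ (length-map _ (subsetsOfSize t k)) (length-map _ (subsetsOfSize t (suc k))) ⟩
  length (subsetsOfSize t k) + length (subsetsOfSize t (suc k))
    ≡⟨ cong₂ _+_ (length-subsetsOfSize t k) (length-subsetsOfSize t (suc k)) ⟩
  ∣ t ∣ C k + ∣ t ∣ C suc k
    ≡⟨ nCk+nC[k+1]≡[n+1]C[k+1] ∣ t ∣ k ⟩
  suc ∣ t ∣ C suc k ∎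
  where open ≡-Reasoning

∈-subsetsOfSize : {p t : Subset n} → p ⊆ t → ∣ p ∣ ≡ k → p List.∈ subsetsOfSize t k
∈-subsetsOfSize {p = []}          {[]}          _   refl = here refl
∈-subsetsOfSize {p = outside ∷ p} {outside ∷ t} p⊆t ∣p∣≡k =
  ∈-map⁺ (outside ∷_) (∈-subsetsOfSize (drop-∷-⊆ p⊆t) ∣p∣≡k)
∈-subsetsOfSize {k = zero}  {outside ∷ p} {inside ∷ t} p⊆t ∣p∣≡0 =
  ∈-map⁺ (outside ∷_) (∈-subsetsOfSize (drop-∷-⊆ p⊆t) ∣p∣≡0)
∈-subsetsOfSize {k = suc k} {outside ∷ p} {inside ∷ t} p⊆t ∣p∣≡k =
  ∈-++⁺ʳ (map (inside ∷_) (subsetsOfSize t k)) (∈-map⁺ (outside ∷_) (∈-subsetsOfSize (drop-∷-⊆ p⊆t) ∣p∣≡k))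
∈-subsetsOfSize {p = inside ∷ p}  {outside ∷ t} p⊆t _ with p⊆t Vector.here
... | ()
∈-subsetsOfSize {k = suc k} {inside ∷ p} {inside ∷ t} p⊆t refl =
  ∈-++⁺ˡ (∈-map⁺ (inside ∷_) (∈-subsetsOfSize (drop-∷-⊆ p⊆t) refl))

injective-subsets-≤-C : {m : ℕ} {t : Subset n} (T : Fin m → Subset n) → Injective _≡_ _≡_ T →
  (∀ i → T i ⊆ t) → (∀ i → ∣ T i ∣ ≡ k) → m ≤ ∣ t ∣ C k
injective-subsets-≤-C {k = k} {t = t} T T-injective T⊆t ∣T∣≡k =
  subst (_ ≤_) (length-subsetsOfSize t k) (injective⇒≤ position-injective)
  where
  T∈ : ∀ i → T i List.∈ subsetsOfSize t k
  T∈ i = ∈-subsetsOfSize (T⊆t i) (∣T∣≡k i)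
  position-injective : Injective _≡_ _≡_ (index ∘ T∈)
  position-injective {i} {j} eq = T-injective (begin
    T i                                       ≡⟨ lookup-index (T∈ i) ⟩
    lookup (subsetsOfSize t k) (index (T∈ i)) ≡⟨ cong (lookup (subsetsOfSize t k)) eq ⟩
    lookup (subsetsOfSize t k) (index (T∈ j)) ≡⟨ lookup-index (T∈ j) ⟨
    T j                                       ∎)
    where open ≡-Reasoning

𝟙 : Bool → ℕ
𝟙 true  = 1
𝟙 false = 0

𝟙-∧ : ∀ x y → 𝟙 (x ∧ y) ≡ 𝟙 x * 𝟙 y
𝟙-∧ true  y = sym (ℕ.+-identityʳ (𝟙 y))
𝟙-∧ false y = refl

∣x∷p∣ : ∀ x (p : Subset n) → ∣ x ∷ p ∣ ≡ 𝟙 x + ∣ p ∣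
∣x∷p∣ true  p = refl
∣x∷p∣ false p = refl

∣tabulate∣ : (f : Fin n → Bool) → ∣ tabulate f ∣ ≡ sum (𝟙 ∘ f)
∣tabulate∣ {zero}  f = refl
∣tabulate∣ {suc n} f = trans (∣x∷p∣ (f zero) (tabulate (f ∘ suc))) (cong (_+_ (𝟙 (f zero))) (∣tabulate∣ (f ∘ suc)))

tabulate-∩ : (f g : Fin n → Bool) → tabulate f ∩ tabulate g ≡ tabulate (λ i → f i ∧ g i)
tabulate-∩ {zero}  f g = refl
tabulate-∩ {suc n} f g = cong (f zero ∧ g zero ∷_) (tabulate-∩ (f ∘ suc) (g ∘ suc))

∈-tabulate⇔ : (f : Fin n → Bool) (i : Fin n) → i ∈ tabulate f ⇔ f i ≡ true
∈-tabulate⇔ f i = mk⇔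
  (λ i∈f → trans (sym (lookup∘tabulate f i)) (Inverse.to []=↔lookup i∈f))
  (λ fi≡true → Inverse.from []=↔lookup (trans (lookup∘tabulate f i) fi≡true))

isNonZero : ℤ → Bool
isNonZero (+ zero)  = false
isNonZero (+ suc _) = true
isNonZero -[1+ _ ]  = true

isNonZero⇔≢0 : ∀ z → isNonZero z ≡ true ⇔ z ≢ + 0
isNonZero⇔≢0 (+ zero)  = mk⇔ (λ ()) (λ z≢0 → ⊥-elim (z≢0 refl))
isNonZero⇔≢0 (+ suc _) = mk⇔ (λ _ ()) (λ _ → refl)
isNonZero⇔≢0 -[1+ _ ]  = mk⇔ (λ _ ()) (λ _ → refl)

𝟙-isNonZero : ∀ {z} → Sign z → 𝟙 (isNonZero z) ≡ ℤ.∣ z ∣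
𝟙-isNonZero 0ˢ  = refl
𝟙-isNonZero +1ˢ = refl
𝟙-isNonZero -1ˢ = refl

support : (Fin n → ℤ) → Subset n
support v = tabulate (isNonZero ∘ v)

∈-support⇔ : (v : Fin n → ℤ) (i : Fin n) → i ∈ support v ⇔ v i ≢ + 0
∈-support⇔ v i = ⇔.trans (∈-tabulate⇔ (isNonZero ∘ v) i) (isNonZero⇔≢0 (v i))

∣support∣ : {v : Fin n → ℤ} → (∀ i → Sign (v i)) → ∣ support v ∣ ≡ sum (ℤ.∣_∣ ∘ v)
∣support∣ {v = v} sign-v = trans (∣tabulate∣ (isNonZero ∘ v)) (sum-cong-≗ (𝟙-isNonZero ∘ sign-v))

∣support∩support∣ : {u v : Fin n → ℤ} → (∀ i → Sign (u i)) → (∀ i → Sign (v i)) →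
  ∣ support u ∩ support v ∣ ≡ sum (λ i → ℤ.∣ u i ∣ * ℤ.∣ v i ∣)
∣support∩support∣ {u = u} {v} sign-u sign-v = begin
  ∣ support u ∩ support v ∣
    ≡⟨ cong ∣_∣ (tabulate-∩ (isNonZero ∘ u) (isNonZero ∘ v)) ⟩
  ∣ tabulate (λ i → isNonZero (u i) ∧ isNonZero (v i)) ∣
    ≡⟨ ∣tabulate∣ (λ i → isNonZero (u i) ∧ isNonZero (v i)) ⟩
  sum (λ i → 𝟙 (isNonZero (u i) ∧ isNonZero (v i)))
    ≡⟨ sum-cong-≗ (λ i → trans (𝟙-∧ (isNonZero (u i)) (isNonZero (v i)))
                              (cong₂ _*_ (𝟙-isNonZero (sign-u i)) (𝟙-isNonZero (sign-v i)))) ⟩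
  sum (λ i → ℤ.∣ u i ∣ * ℤ.∣ v i ∣) ∎
  where open ≡-Reasoning

ε-self : (a : Fin (suc ℓ)) → ε a a ≡ + 1
ε-self a with a ≟ a
... | yes _   = refl
... | no a≢a = ⊥-elim (a≢a refl)

ε-≢ : {a c : Fin (suc ℓ)} → c ≢ a → ε a c ≡ + 0
ε-≢ {a = a} {c} c≢a with c ≟ a
... | yes c≡a = ⊥-elim (c≢a c≡a)
... | no _    = refl

sign-ε : (a c : Fin (suc ℓ)) → Sign (ε a c)
sign-ε a c with c ≟ a
... | yes _ = +1ˢ
... | no _  = 0ˢ

∑∣ε∣≡1 : (a : Fin (suc ℓ)) → sum (λ c → ℤ.∣ ε a c ∣) ≡ 1
∑∣ε∣≡1 {ℓ} a = begin
  sum (λ c → ℤ.∣ ε a c ∣)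
    ≡⟨ sum-remove {i = a} (λ c → ℤ.∣ ε a c ∣) ⟩
  ℤ.∣ ε a a ∣ + sum (λ j → ℤ.∣ ε a (punchIn a j) ∣)
    ≡⟨ cong₂ _+_ (cong ℤ.∣_∣ (ε-self a)) (sum-cong-≗ (λ j → cong ℤ.∣_∣ (ε-≢ (punchInᵢ≢i a j)))) ⟩
  1 + sum {ℓ} (λ _ → 0)
    ≡⟨ cong (_+_ 1) (sum-replicate-zero ℓ) ⟩
  1 ∎
  where open ≡-Reasoning

Avoids : Fin (suc ℓ) → Root ℓ → Set
Avoids c r = a r ≢ c × b r ≢ c

vecR-avoids : {c : Fin (suc ℓ)} (r : Root ℓ) → Avoids c r → vecR r c ≡ + 0
vecR-avoids r (a≢c , b≢c) = cong₂ ℤ._-_ (ε-≢ (≢-sym a≢c)) (ε-≢ (≢-sym b≢c))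

ε-disjoint : (r : Root ℓ) (c : Fin (suc ℓ)) → ε (a r) c ≡ + 0 ⊎ - ε (b r) c ≡ + 0
ε-disjoint r c with c ≟ a r
... | yes c≡a = inj₂ (cong -_ (ε-≢ (λ c≡b → a≢b r (trans (sym c≡a) c≡b))))
... | no _    = inj₁ refl

sign-vecR : (r : Root ℓ) (c : Fin (suc ℓ)) → Sign (vecR r c)
sign-vecR r c = sign-+-disjoint (sign-ε (a r) c) (sign-neg (sign-ε (b r) c)) (ε-disjoint r c)

∑∣vecR∣≡2 : (r : Root ℓ) → sum (λ c → ℤ.∣ vecR r c ∣) ≡ 2
∑∣vecR∣≡2 r = begin
  sum (λ c → ℤ.∣ vecR r c ∣)
    ≡⟨ sum-cong-≗ (λ c → trans (∣+∣-disjoint (ε-disjoint r c)) (cong (_+_ ℤ.∣ ε (a r) c ∣) (ℤ.∣-i∣≡∣i∣ (ε (b r) c)))) ⟩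
  sum (λ c → ℤ.∣ ε (a r) c ∣ + ℤ.∣ ε (b r) c ∣)
    ≡⟨ ∑-distrib-+ (λ c → ℤ.∣ ε (a r) c ∣) (λ c → ℤ.∣ ε (b r) c ∣) ⟩
  sum (λ c → ℤ.∣ ε (a r) c ∣) + sum (λ c → ℤ.∣ ε (b r) c ∣)
    ≡⟨ cong₂ _+_ (∑∣ε∣≡1 (a r)) (∑∣ε∣≡1 (b r)) ⟩
  2 ∎
  where open ≡-Reasoning

-- ∣ Γ ∣Γ is definitionally ∑roots (roots Γ).
∑roots : List (Root ℓ) → Vec ℓ
∑roots rs c = foldr (λ r s → vecR r c ℤ.+ s) (+ 0) rs

∑roots-avoids : {c : Fin (suc ℓ)} (rs : List (Root ℓ)) → All (Avoids c) rs → ∑roots rs c ≡ + 0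
∑roots-avoids []       []         = refl
∑roots-avoids (r ∷ rs) (r-avoids ∷ rs-avoid) =
  cong₂ ℤ._+_ (vecR-avoids r r-avoids) (∑roots-avoids rs rs-avoid)

vecR-or-∑roots-zero : (r : Root ℓ) (rs : List (Root ℓ)) → All (StronglyOrthogonal r) rs →
  (c : Fin (suc ℓ)) → vecR r c ≡ + 0 ⊎ ∑roots rs c ≡ + 0
vecR-or-∑roots-zero r rs r⊥rs c with c ≟ a r | c ≟ b r
... | yes refl | _        = inj₂ (∑roots-avoids rs (All.map (λ (a≢a′ , a≢b′ , _) → ≢-sym a≢a′ , ≢-sym a≢b′) r⊥rs))
... | no _     | yes refl = inj₂ (∑roots-avoids rs (All.map (λ (_ , _ , b≢a′ , b≢b′) → ≢-sym b≢a′ , ≢-sym b≢b′) r⊥rs))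
... | no _     | no _     = inj₁ refl

sign-∑roots : (rs : List (Root ℓ)) → AllPairs StronglyOrthogonal rs → (c : Fin (suc ℓ)) → Sign (∑roots rs c)
sign-∑roots []       []              c = 0ˢ
sign-∑roots (r ∷ rs) (r⊥rs ∷ rs-SO) c =
  sign-+-disjoint (sign-vecR r c) (sign-∑roots rs rs-SO c) (vecR-or-∑roots-zero r rs r⊥rs c)

∑∣∑roots∣ : (rs : List (Root ℓ)) → AllPairs StronglyOrthogonal rs →
  sum (λ c → ℤ.∣ ∑roots rs c ∣) ≡ 2 * length rs
∑∣∑roots∣ {ℓ} []       []              = sum-replicate-zero (suc ℓ)
∑∣∑roots∣     (r ∷ rs) (r⊥rs ∷ rs-SO) = begin
  sum (λ c → ℤ.∣ vecR r c ℤ.+ ∑roots rs c ∣)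
    ≡⟨ sum-cong-≗ (λ c → ∣+∣-disjoint (vecR-or-∑roots-zero r rs r⊥rs c)) ⟩
  sum (λ c → ℤ.∣ vecR r c ∣ + ℤ.∣ ∑roots rs c ∣)
    ≡⟨ ∑-distrib-+ (λ c → ℤ.∣ vecR r c ∣) (λ c → ℤ.∣ ∑roots rs c ∣) ⟩
  sum (λ c → ℤ.∣ vecR r c ∣) + sum (λ c → ℤ.∣ ∑roots rs c ∣)
    ≡⟨ cong₂ _+_ (∑∣vecR∣≡2 r) (∑∣∑roots∣ rs rs-SO) ⟩
  2 + 2 * length rs
    ≡⟨ ℕ.*-suc 2 (length rs) ⟨
  2 * suc (length rs) ∎
  where open ≡-Reasoning

sign-∣Γ∣ : (Γ : SOS k ℓ) (c : Fin (suc ℓ)) → Sign (∣ Γ ∣Γ c)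
sign-∣Γ∣ Γ = sign-∑roots (roots Γ) (pairSO Γ)

∑∣∣Γ∣∣≡2k : (Γ : SOS k ℓ) → sum (λ c → ℤ.∣ ∣ Γ ∣Γ c ∣) ≡ 2 * k
∑∣∣Γ∣∣≡2k Γ = trans (∑∣∑roots∣ (roots Γ) (pairSO Γ)) (cong (2 *_) (size Γ))

∑∣Γ∣∣Γ′∣≡k : (Γ Γ′ Δ : SOS k ℓ) → (∀ c → ∣ Γ ∣Γ c ℤ.- ∣ Γ′ ∣Γ c ≡ ∣ Δ ∣Γ c) →
  sum (λ c → ℤ.∣ ∣ Γ ∣Γ c ∣ * ℤ.∣ ∣ Γ′ ∣Γ c ∣) ≡ k
∑∣Γ∣∣Γ′∣≡k {k} Γ Γ′ Δ Γ-Γ′≡Δ =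
  ℕ.*-cancelˡ-≡ common k 2 (ℕ.+-cancelˡ-≡ (2 * k) _ _ norms)
  where
  open ≡-Reasoning
  common : ℕ
  common = sum (λ c → ℤ.∣ ∣ Γ ∣Γ c ∣ * ℤ.∣ ∣ Γ′ ∣Γ c ∣)
  sign-Γ-Γ′ : ∀ c → Sign (∣ Γ ∣Γ c ℤ.- ∣ Γ′ ∣Γ c)
  sign-Γ-Γ′ c = subst Sign (sym (Γ-Γ′≡Δ c)) (sign-∣Γ∣ Δ c)
  norms : 2 * k + 2 * common ≡ 2 * k + 2 * k
  norms = begin
    2 * k + 2 * common
      ≡⟨ cong (λ t → t + 2 * common) (trans (sum-cong-≗ (cong ℤ.∣_∣ ∘ Γ-Γ′≡Δ)) (∑∣∣Γ∣∣≡2k Δ)) ⟨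
    sum (λ c → ℤ.∣ ∣ Γ ∣Γ c ℤ.- ∣ Γ′ ∣Γ c ∣) + 2 * common
      ≡⟨ ∑∣u-v∣+2∑∣u∣∣v∣≡∑∣u∣+∑∣v∣ (sign-∣Γ∣ Γ) (sign-∣Γ∣ Γ′) sign-Γ-Γ′ ⟩
    sum (λ c → ℤ.∣ ∣ Γ ∣Γ c ∣) + sum (λ c → ℤ.∣ ∣ Γ′ ∣Γ c ∣)
      ≡⟨ cong₂ _+_ (∑∣∣Γ∣∣≡2k Γ) (∑∣∣Γ∣∣≡2k Γ′) ⟩
    2 * k + 2 * k ∎

sharedSupport : SOS k ℓ → SOS k ℓ → Subset (suc ℓ)
sharedSupport Γ Γ′ = support ∣ Γ ∣Γ ∩ support ∣ Γ′ ∣Γ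

∈-sharedSupport⇔InS : (Γ Γ′ : SOS k ℓ) (c : Fin (suc ℓ)) → c ∈ sharedSupport Γ Γ′ ⇔ InS Γ Γ′ c
∈-sharedSupport⇔InS Γ Γ′ c = ⇔.trans ∩⇔× (mk⇔
  (λ (c∈Γ , c∈Γ′) → Equivalence.to (∈-support⇔ ∣ Γ ∣Γ c) c∈Γ , Equivalence.to (∈-support⇔ ∣ Γ′ ∣Γ c) c∈Γ′)
  (λ (Γc≢0 , Γ′c≢0) → Equivalence.from (∈-support⇔ ∣ Γ ∣Γ c) Γc≢0 , Equivalence.from (∈-support⇔ ∣ Γ′ ∣Γ c) Γ′c≢0))

sharedSupport-≡⇒SameS : (Γ Γ′ Δ Δ′ : SOS k ℓ) → sharedSupport Γ Γ′ ≡ sharedSupport Δ Δ′ → SameS Γ Γ′ Δ Δ′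
sharedSupport-≡⇒SameS Γ Γ′ Δ Δ′ eq c =
  ⇔.trans (⇔.sym (∈-sharedSupport⇔InS Γ Γ′ c))
    (subst (λ p → c ∈ p ⇔ InS Δ Δ′ c) (sym eq) (∈-sharedSupport⇔InS Δ Δ′ c))

∣support∣Γ∣∣≡2k : (Γ : SOS k ℓ) → ∣ support ∣ Γ ∣Γ ∣ ≡ 2 * k
∣support∣Γ∣∣≡2k Γ = trans (∣support∣ (sign-∣Γ∣ Γ)) (∑∣∣Γ∣∣≡2k Γ)

∣sharedSupport∣≡k : {m : ℕ} (F : Fin m → SOS k ℓ) → IsSOSClique F →
  {i j : Fin m} → i ≢ j → ∣ sharedSupport (F i) (F j) ∣ ≡ k
∣sharedSupport∣≡k F clique {i} {j} i≢j =
  trans (∣support∩support∣ (sign-∣Γ∣ (F i)) (sign-∣Γ∣ (F j)))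
        (∑∣Γ∣∣Γ′∣≡k (F i) (F j) (proj₁ (clique i j i≢j)) (proj₂ (clique i j i≢j)))

lemma3p3 : (k ℓ m : ℕ) → 1 ≤ k → 1 ≤ ℓ →
    (F : Fin m → SOS k ℓ) →
    (∀ i j → i ≢ j → ¬ (F i ≈Γ F j)) →
    IsSOSClique F →
    (∀ i j x y → i ≢ j → x ≢ y →
      SameS (F i) (F j) (F x) (F y) ⇔ SamePair i j x y) →
    m ≤ (2 * k) C k + 1
lemma3p3 k ℓ zero    _ _ F _ _      _        = z≤n
lemma3p3 k ℓ (suc m) _ _ F _ clique S-unique = subst (suc m ≤_) (ℕ.+-comm 1 ((2 * k) C k)) (s≤s bound)
  where
  Γ₀ : SOS k ℓ
  Γ₀ = F zero
  T : Fin m → Subset (suc ℓ)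
  T j = sharedSupport Γ₀ (F (suc j))
  T-injective : Injective _≡_ _≡_ T
  T-injective {i} {j} Ti≡Tj
    with Equivalence.to (S-unique zero (suc i) zero (suc j) (λ ()) (λ ()))
                        (sharedSupport-≡⇒SameS Γ₀ (F (suc i)) Γ₀ (F (suc j)) Ti≡Tj)
  ... | inj₁ (_ , refl) = refl
  ... | inj₂ (() , _)
  T⊆support-Γ₀ : ∀ j → T j ⊆ support ∣ Γ₀ ∣Γ
  T⊆support-Γ₀ j = p∩q⊆p (support ∣ Γ₀ ∣Γ) (support ∣ F (suc j) ∣Γ)
  bound : m ≤ (2 * k) C k
  bound = subst (λ size → m ≤ size C k) (∣support∣Γ∣∣≡2k Γ₀)
            (injective-subsets-≤-C T T-injective T⊆support-Γ₀ (λ j → ∣sharedSupport∣≡k F clique (λ ())))
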